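{- Let $m,n\ge 2$, let $\alpha\in\mathcal{C}_m(312)$ with $\alpha_{m-1}=2$ (so $\alpha=\alpha_1\cdots\alpha_{m-2}21$), and let $\beta=\beta_1\cdots\beta_{n-1}1\in\mathcal{C}_n(312)$. Define $\alpha*\beta\in S_{m+n-2}$ by $$\alpha*\beta=\alpha_1\alpha_2\cdots\alpha_{m-2}\,\bar\beta_1\bar\beta_2\cdots\bar\beta_{n-1}\,1,$$ where $\bar\beta_i=\beta_i+m-2$ if $\beta_i\neq 2$ and $\bar\beta_i=2$ if $\beta_i=2$. Then $\alpha*\beta\in\mathcal{C}_{m+n-2}(312)$.
   Context: $\mathcal{C}_n(\sigma)$ is the set of permutations of $[n]$ (in one-line notation) that consist of a single $n$-cycle and avoid the pattern $\sigma$, where $\pi$ avoids $\sigma\in S_k$ if no subsequence of $\pi$ of length $k$ is in the same relative order as $\sigma$. Every element of $\mathcal{C}_n(312)$ ends in $1$. -}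

module Defs where

open import Data.Nat using (ℕ; zero; suc; _+_; _∸_; _≤_; _<_; _≡ᵇ_)
open import Data.Bool using (if_then_else_)
open import Data.List using (List; []; _∷_; _++_; map; upTo; length)
open import Data.List.Relation.Binary.Permutation.Propositional using (_↭_)
open import Data.List.Relation.Binary.Sublist.Propositional using (_⊆_)
open import Data.Product using (_×_; ∃-syntax)
open import Relation.Binary.PropositionalEquality using (_≡_)
open import Relation.Nullary using (¬_)
open import Function.Bundles using (_⇔_)
open import Function using (_∘_)

-- 0-indexed entry of a list (0 if out of range)
at : List ℕ → ℕ → ℕ
at []       _       = 0
at (x ∷ xs) zero    = x
at (x ∷ xs) (suc i) = at xs i

-- π is a permutation of [n] = {1,…,n} in one-line notation
IsPerm : ℕ → List ℕ → Set
IsPerm n π = π ↭ map suc (upTo n)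

-- the permutation as a map i ↦ π_i (1-indexed)
apply : List ℕ → ℕ → ℕ
apply π i = at π (i ∸ 1)

iter : List ℕ → ℕ → ℕ → ℕ
iter π zero    i = i
iter π (suc k) i = apply π (iter π k i)

-- π (a permutation of [n]) consists of a single n-cycle:
-- the orbit of 1 contains every element of [n]
IsCycle : ℕ → List ℕ → Set
IsCycle n π = ∀ j → 1 ≤ j → j ≤ n → ∃[ k ] iter π k 1 ≡ j

SameOrder : List ℕ → List ℕ → Set
SameOrder τ σ = ∀ i j → i < length σ → j < length σ →
  (at τ i < at τ j) ⇔ (at σ i < at σ j)

Contains : List ℕ → List ℕ → Set
Contains σ π = ∃[ τ ] (τ ⊆ π × length τ ≡ length σ × SameOrder τ σ)

Avoids : List ℕ → List ℕ → Set
Avoids σ π = ¬ Contains σ π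

InC : ℕ → List ℕ → List ℕ → Set
InC n σ π = IsPerm n π × IsCycle n π × Avoids σ π

p312 : List ℕ
p312 = 3 ∷ 1 ∷ 2 ∷ []

bar : ℕ → ℕ → ℕ
bar m b = if b ≡ᵇ 2 then 2 else b + m ∸ 2

-- α * β where α = αpre ++ [2,1], β = βpre ++ [1]
star : ℕ → List ℕ → List ℕ → List ℕ
star m αpre βpre = αpre ++ map (bar m) βpre ++ 1 ∷ []

-- A 312 in γ cannot end in the final 1, and it cannot straddle the α-part and the
-- β̄-part, because every β̄-entry below an α-entry equals 2; so it would lie in the
-- α-part or, as β ↦ β̄ preserves order, come from a 312 in β.
-- As a map, γ agrees with α on 1 … m-2 and with β shifted by m-2 on m-1 … m+n-3,
-- except that γ sends the β-preimage of 2 (shifted) to 2 and m+n-2 to 1.  Thus the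
-- γ-orbit of 1 runs along the α-orbit from 1 to m-1, along the β-orbit from 1 to the
-- preimage of 2, along the α-orbit from 2 to m and along the β-orbit from 2 to n.
-- Formally, "T or x is γ-reachable from 1" is invariant along α-orbits (resp. β-orbits
-- shifted by m-2) once T absorbs the exits not yet known to be reachable; choosing T
-- suitably gives, in turn, that m-1, 2, m and then every point are reachable.

module Submission where

open import Defs
open import Data.Nat using (ℕ; zero; suc; _+_; _∸_; _≤_; _<_; z≤n; s≤s; s≤s⁻¹; _≤?_)
open import Data.Nat.Properties
open import Data.List using (List; []; _∷_; _++_; map; length; upTo; applyUpTo)
open import Data.List.Properties using (map-upTo; length-map; ++-assoc; ++-identityʳ)
open import Data.List.Membership.Propositional using (_∈_)
open import Data.List.Relation.Unary.Any using (here; there)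
open import Data.List.Relation.Unary.All as All using (All; []; _∷_; tabulate)
import Data.List.Relation.Unary.All.Properties as All
open import Data.List.Relation.Binary.Sublist.Propositional using (_⊆_; []; _∷_; _∷ʳ_)
open import Data.List.Relation.Binary.Sublist.Propositional.Properties using (All-resp-⊆; ++⁺ʳ)
open import Data.List.Relation.Binary.Permutation.Propositional
  using (_↭_; ↭-refl; ↭-sym; ↭-trans; ↭-prep; ↭-swap; module PermutationReasoning)
import Data.List.Relation.Binary.Permutation.Propositional.Properties as ↭
open import Data.Product using (_×_; _,_; proj₁; proj₂; ∃-syntax)
open import Data.Sum as Sum using (_⊎_; inj₁; inj₂; [_,_]′; reduce; fromInj₂)
open import Data.Empty using (⊥; ⊥-elim)
open import Function using (_∘_)
open import Function.Bundles using (Equivalence; _⇔_; mk⇔)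
open import Relation.Binary.Definitions using (tri<; tri≈; tri>)
open import Relation.Binary.PropositionalEquality
open import Relation.Nullary using (¬_; yes; no; contradiction)

at-++ˡ : ∀ xs ys {i} → i < length xs → at (xs ++ ys) i ≡ at xs i
at-++ˡ (x ∷ xs) ys {zero}  _   = refl
at-++ˡ (x ∷ xs) ys {suc i} i<l = at-++ˡ xs ys (s≤s⁻¹ i<l)

at-++ʳ : ∀ xs ys {k} i → length xs ≡ k → at (xs ++ ys) (k + i) ≡ at ys i
at-++ʳ []       ys i refl = refl
at-++ʳ (x ∷ xs) ys i refl = at-++ʳ xs ys i refl

at-map : ∀ f xs {i} → i < length xs → at (map f xs) i ≡ f (at xs i)
at-map f (x ∷ xs) {zero}  _   = refl
at-map f (x ∷ xs) {suc i} i<l = at-map f xs (s≤s⁻¹ i<l)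

at-∈ : ∀ xs {i} → i < length xs → at xs i ∈ xs
at-∈ (x ∷ xs) {zero}  _   = here refl
at-∈ (x ∷ xs) {suc i} i<l = there (at-∈ xs (s≤s⁻¹ i<l))

interval : ℕ → ℕ → List ℕ
interval a zero    = []
interval a (suc k) = suc a ∷ interval (suc a) k

length-interval : ∀ a k → length (interval a k) ≡ k
length-interval a zero    = refl
length-interval a (suc k) = cong suc (length-interval (suc a) k)

interval-++ : ∀ a k l → interval a (k + l) ≡ interval a k ++ interval (a + k) l
interval-++ a zero    l = cong (λ b → interval b l) (sym (+-identityʳ a))
interval-++ a (suc k) l = cong (suc a ∷_)
  (trans (interval-++ (suc a) k l) (cong (λ b → interval (suc a) k ++ interval b l) (sym (+-suc a k))))

∈-interval⁻ : ∀ a k {x} → x ∈ interval a k → a < x × x ≤ a + k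
∈-interval⁻ a (suc k) (here refl) = ≤-refl , subst (suc a ≤_) (sym (+-suc a k)) (s≤s (m≤m+n a k))
∈-interval⁻ a (suc k) {x} (there x∈) =
  let a<x , x≤ = ∈-interval⁻ (suc a) k x∈ in <⇒≤ a<x , subst (x ≤_) (sym (+-suc a k)) x≤

applyUpTo-interval : ∀ f a k → (∀ i → f i ≡ suc (a + i)) → applyUpTo f k ≡ interval a k
applyUpTo-interval f a zero    f≗ = refl
applyUpTo-interval f a (suc k) f≗ = cong₂ _∷_ (trans (f≗ 0) (cong suc (+-identityʳ a)))
  (applyUpTo-interval (f ∘ suc) (suc a) k (λ i → trans (f≗ (suc i)) (cong suc (+-suc a i))))

map-suc-upTo : ∀ n → map suc (upTo n) ≡ interval 0 n
map-suc-upTo n = trans (map-upTo suc n) (applyUpTo-interval suc 0 n (λ _ → refl))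

InRange : ℕ → ℕ → Set
InRange n x = 1 ≤ x × x ≤ n

apply-inRange : ∀ {n π x} → π ↭ interval 0 n → InRange n x → InRange n (apply π x)
apply-inRange {n} {π} {suc i} π↭ (_ , i<n) = ∈-interval⁻ 0 n (↭.∈-resp-↭ π↭ (at-∈ π i<l))
  where
  i<l : i < length π
  i<l = subst (i <_) (sym (trans (↭.↭-length π↭) (length-interval 0 n))) i<n

iter-preserves : ∀ π (P : ℕ → Set) → (∀ {x} → P x → P (apply π x)) →
                 ∀ k {x} → P x → P (iter π k x)
iter-preserves π P step zero    p = p
iter-preserves π P step (suc k) p = step (iter-preserves π P step k p)

iter-inRange : ∀ {n π} → π ↭ interval 0 n → ∀ k {x} → InRange n x → InRange n (iter π k x)
iter-inRange π↭ = iter-preserves _ _ (apply-inRange π↭)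

Is312 : List ℕ → Set
Is312 (a ∷ b ∷ c ∷ []) = b < c × c < a
Is312 _                = ⊥

Contains-312⁻ : ∀ {π} → Contains p312 π → ∃[ τ ] (τ ⊆ π × Is312 τ)
Contains-312⁻ ((a ∷ b ∷ c ∷ []) , τ⊆π , refl , order) =
  (a ∷ b ∷ c ∷ []) , τ⊆π ,
  Equivalence.from (order 1 2 (s≤s (s≤s z≤n)) (s≤s (s≤s (s≤s z≤n)))) (s≤s (s≤s z≤n)) ,
  Equivalence.from (order 2 0 (s≤s (s≤s (s≤s z≤n))) (s≤s z≤n)) (s≤s (s≤s (s≤s z≤n)))

Contains-312⁺ : ∀ {π τ} → τ ⊆ π → Is312 τ → Contains p312 π
Contains-312⁺ {τ = a ∷ b ∷ c ∷ []} τ⊆π (b<c , c<a) = (a ∷ b ∷ c ∷ []) , τ⊆π , refl , order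
  where
  both-hold : ∀ {A B : Set} → A → B → A ⇔ B
  both-hold a b = mk⇔ (λ _ → b) (λ _ → a)
  both-fail : ∀ {A B : Set} → ¬ A → ¬ B → A ⇔ B
  both-fail ¬a ¬b = mk⇔ (⊥-elim ∘ ¬a) (⊥-elim ∘ ¬b)
  order : SameOrder (a ∷ b ∷ c ∷ []) p312
  order 0 0 _ _ = both-fail (<-irrefl refl) (<-irrefl refl)
  order 0 1 _ _ = both-fail (<-asym (<-trans b<c c<a)) λ { (s≤s ()) }
  order 0 2 _ _ = both-fail (<-asym c<a) λ { (s≤s (s≤s ())) }
  order 1 0 _ _ = both-hold (<-trans b<c c<a) (s≤s (s≤s z≤n))
  order 1 1 _ _ = both-fail (<-irrefl refl) (<-irrefl refl)
  order 1 2 _ _ = both-hold b<c (s≤s (s≤s z≤n))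
  order 2 0 _ _ = both-hold c<a (s≤s (s≤s (s≤s z≤n)))
  order 2 1 _ _ = both-fail (<-asym b<c) λ { (s≤s ()) }
  order 2 2 _ _ = both-fail (<-irrefl refl) (<-irrefl refl)
  order (suc (suc (suc _))) _ (s≤s (s≤s (s≤s ()))) _
  order _ (suc (suc (suc _))) _ (s≤s (s≤s (s≤s ())))

-- Every ys-entry below an xs-entry is 2, which leaves no room for a straddling occurrence.
Is312-++⁻ : ∀ {m} xs ys → All (λ x → 2 < x × x ≤ m) xs → All (λ y → y ≡ 2 ⊎ m < y) ys →
            Is312 (xs ++ ys) → Is312 xs ⊎ Is312 ys
Is312-++⁻ {m} = split
  where
  below⇒2 : ∀ {a y} → 2 < a × a ≤ m → y ≡ 2 ⊎ m < y → y < a → y ≡ 2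
  below⇒2 _        (inj₁ y≡2) _   = y≡2
  below⇒2 (_ , a≤m) (inj₂ m<y) y<a = ⊥-elim (<-asym m<y (<-≤-trans y<a a≤m))
  split : ∀ xs ys → All (λ x → 2 < x × x ≤ m) xs → All (λ y → y ≡ 2 ⊎ m < y) ys →
          Is312 (xs ++ ys) → Is312 xs ⊎ Is312 ys
  split []                  ys _ _ occ = inj₂ occ
  split (_ ∷ _ ∷ _ ∷ [])    [] _ _ occ = inj₁ occ
  split (a ∷ [])     (b ∷ c ∷ []) (la ∷ []) (hb ∷ hc ∷ []) (b<c , c<a)
    with below⇒2 la hc c<a | below⇒2 la hb (<-trans b<c c<a)
  ... | refl | refl = ⊥-elim (<-irrefl refl b<c)
  split (a ∷ b ∷ []) (c ∷ []) (la ∷ lb ∷ []) (hc ∷ []) (b<c , c<a) with below⇒2 la hc c<a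
  ... | refl = ⊥-elim (<-asym b<c (proj₁ lb))
  split (_ ∷ [])            []              _ _ ()
  split (_ ∷ [])            (_ ∷ [])        _ _ ()
  split (_ ∷ [])            (_ ∷ _ ∷ _ ∷ _) _ _ ()
  split (_ ∷ _ ∷ [])        []              _ _ ()
  split (_ ∷ _ ∷ [])        (_ ∷ _ ∷ _)     _ _ ()
  split (_ ∷ _ ∷ _ ∷ [])    (_ ∷ _)         _ _ ()
  split (_ ∷ _ ∷ _ ∷ _ ∷ _) _               _ _ ()

¬Is312-∷ʳ-minimum : ∀ {c} xs → All (c ≤_) xs → ¬ Is312 (xs ++ c ∷ [])
¬Is312-∷ʳ-minimum (a ∷ b ∷ [])        (_ ∷ c≤b ∷ []) (b<c , _) = <⇒≱ b<c c≤b
¬Is312-∷ʳ-minimum []                  _ ()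
¬Is312-∷ʳ-minimum (_ ∷ [])            _ ()
¬Is312-∷ʳ-minimum (_ ∷ _ ∷ _ ∷ [])    _ ()
¬Is312-∷ʳ-minimum (_ ∷ _ ∷ _ ∷ _ ∷ _) _ ()

Is312-map⁻ : ∀ {P : ℕ → Set} f → (∀ {x y} → P x → P y → f x < f y → x < y) →
             ∀ {τ} → All P τ → Is312 (map f τ) → Is312 τ
Is312-map⁻ f reflects {a ∷ b ∷ c ∷ []} (pa ∷ pb ∷ pc ∷ []) (b<c , c<a) =
  reflects pb pc b<c , reflects pc pa c<a
Is312-map⁻ f _ {[]}                _ ()
Is312-map⁻ f _ {_ ∷ []}            _ ()
Is312-map⁻ f _ {_ ∷ _ ∷ []}        _ ()
Is312-map⁻ f _ {_ ∷ _ ∷ _ ∷ _ ∷ _} _ ()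

⊆-++⁻ : ∀ {τ : List ℕ} xs ys → τ ⊆ xs ++ ys → ∃[ τ₁ ] ∃[ τ₂ ] (τ ≡ τ₁ ++ τ₂ × τ₁ ⊆ xs × τ₂ ⊆ ys)
⊆-++⁻ []       ys τ⊆ = [] , _ , refl , [] , τ⊆
⊆-++⁻ (x ∷ xs) ys (.x ∷ʳ τ⊆) =
  let τ₁ , τ₂ , eq , τ₁⊆ , τ₂⊆ = ⊆-++⁻ xs ys τ⊆ in τ₁ , τ₂ , eq , x ∷ʳ τ₁⊆ , τ₂⊆
⊆-++⁻ (x ∷ xs) ys (refl ∷ τ⊆) =
  let τ₁ , τ₂ , eq , τ₁⊆ , τ₂⊆ = ⊆-++⁻ xs ys τ⊆ in x ∷ τ₁ , τ₂ , cong (x ∷_) eq , refl ∷ τ₁⊆ , τ₂⊆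

⊆-map⁻ : ∀ {τ : List ℕ} (f : ℕ → ℕ) xs → τ ⊆ map f xs → ∃[ σ ] (τ ≡ map f σ × σ ⊆ xs)
⊆-map⁻ f []       [] = [] , refl , []
⊆-map⁻ f (x ∷ xs) (_ ∷ʳ τ⊆) = let σ , eq , σ⊆ = ⊆-map⁻ f xs τ⊆ in σ , eq , x ∷ʳ σ⊆
⊆-map⁻ f (x ∷ xs) (refl ∷ τ⊆) =
  let σ , eq , σ⊆ = ⊆-map⁻ f xs τ⊆ in x ∷ σ , cong (f x ∷_) eq , refl ∷ σ⊆

bar-≥3 : ∀ m' v → 2 < v → bar (2 + m') v ≡ v + m'
bar-≥3 m' v@(suc (suc (suc _))) _ = begin
  v + (2 + m') ∸ 2 ≡⟨ cong (_∸ 2) (+-comm v (2 + m')) ⟩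
  m' + v           ≡⟨ +-comm m' v ⟩
  v + m'           ∎
  where open ≡-Reasoning
bar-≥3 m' (suc zero)       (s≤s ())
bar-≥3 m' (suc (suc zero)) (s≤s (s≤s ()))

bar-reflects-< : ∀ m' {b c} → 2 ≤ b → 2 ≤ c → bar (2 + m') b < bar (2 + m') c → b < c
bar-reflects-< m' {b} {c} 2≤b 2≤c lt with m≤n⇒m<n∨m≡n 2≤b | m≤n⇒m<n∨m≡n 2≤c
... | inj₂ refl | inj₂ refl = lt
... | inj₂ refl | inj₁ 2<c  = 2<c
... | inj₁ 2<b  | inj₂ refl =
  ⊥-elim (<⇒≱ (subst (_< 2) (bar-≥3 m' b 2<b) lt) (≤-trans (<⇒≤ 2<b) (m≤m+n b m')))
... | inj₁ 2<b  | inj₁ 2<c  = +-cancelʳ-< m' b c (subst₂ _<_ (bar-≥3 m' b 2<b) (bar-≥3 m' c 2<c) lt)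

map-bar-interval : ∀ m' a k → 2 ≤ a → map (bar (2 + m')) (interval a k) ≡ interval (a + m') k
map-bar-interval m' a zero    _   = refl
map-bar-interval m' a (suc k) 2≤a =
  cong₂ _∷_ (bar-≥3 m' (suc a) (s≤s 2≤a)) (map-bar-interval m' (suc a) k (m≤n⇒m≤1+n 2≤a))

module Star (m' n' : ℕ) (αpre βpre : List ℕ)
            (α-perm : IsPerm (2 + m') (αpre ++ 2 ∷ 1 ∷ []))
            (β-perm : IsPerm (2 + n') (βpre ++ 1 ∷ [])) where

  m n : ℕ
  m = 2 + m'
  n = 2 + n'

  α β γ : List ℕ
  α = αpre ++ 2 ∷ 1 ∷ []
  β = βpre ++ 1 ∷ []
  γ = star m αpre βpre

  α↭ : α ↭ interval 0 m
  α↭ = subst (α ↭_) (map-suc-upTo m) α-perm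

  β↭ : β ↭ interval 0 n
  β↭ = subst (β ↭_) (map-suc-upTo n) β-perm

  αpre↭ : αpre ↭ interval 2 m'
  αpre↭ = ↭.drop-∷ (↭.drop-∷ (begin
    1 ∷ 2 ∷ αpre ↭⟨ ↭-swap 1 2 ↭-refl ⟩
    2 ∷ 1 ∷ αpre ↭⟨ ↭.++-comm (2 ∷ 1 ∷ []) αpre ⟩
    α            ↭⟨ α↭ ⟩
    interval 0 m ∎))
    where open PermutationReasoning

  βpre↭ : βpre ↭ 2 ∷ interval 2 n'
  βpre↭ = ↭.drop-∷ (↭-trans (↭.++-comm (1 ∷ []) βpre) β↭)

  length-αpre : length αpre ≡ m'
  length-αpre = trans (↭.↭-length αpre↭) (length-interval 2 m')

  length-βpre : length βpre ≡ suc n'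
  length-βpre = trans (↭.↭-length βpre↭) (cong suc (length-interval 2 n'))

  αpre-values : ∀ {v} → v ∈ αpre → 2 < v × v ≤ m
  αpre-values = ∈-interval⁻ 2 m' ∘ ↭.∈-resp-↭ αpre↭

  βpre-values : ∀ {v} → v ∈ βpre → v ≡ 2 ⊎ (2 < v × v ≤ n)
  βpre-values v∈ with ↭.∈-resp-↭ βpre↭ v∈
  ... | here v≡2 = inj₁ v≡2
  ... | there v∈ = inj₂ (∈-interval⁻ 2 n' v∈)

  γ-perm : IsPerm (m + n ∸ 2) γ
  γ-perm = subst (γ ↭_) (sym (trans (map-suc-upTo (m' + n)) (cong (interval 0) m'+n≡))) (begin
    αpre ++ map (bar m) βpre ++ 1 ∷ []
      ↭⟨ ↭.++⁺ αpre↭ (↭.++⁺ʳ (1 ∷ []) (↭.map⁺ (bar m) βpre↭)) ⟩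
    interval 2 m' ++ 2 ∷ map (bar m) (interval 2 n') ++ 1 ∷ []
      ≡⟨ cong (λ xs → interval 2 m' ++ 2 ∷ xs ++ 1 ∷ []) (map-bar-interval m' 2 n' ≤-refl) ⟩
    interval 2 m' ++ 2 ∷ interval m n' ++ 1 ∷ []
      ↭⟨ ↭.shift 2 (interval 2 m') _ ⟩
    2 ∷ interval 2 m' ++ interval m n' ++ 1 ∷ []
      ≡⟨ cong (2 ∷_) (trans (sym (++-assoc (interval 2 m') _ _))
                            (cong (_++ 1 ∷ []) (sym (interval-++ 2 m' n')))) ⟩
    2 ∷ interval 2 (m' + n') ++ 1 ∷ []
      ↭⟨ ↭-prep 2 (↭-sym (↭.∷↭∷ʳ 1 _)) ⟩
    2 ∷ 1 ∷ interval 2 (m' + n')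
      ↭⟨ ↭-swap 2 1 ↭-refl ⟩
    interval 0 (2 + (m' + n')) ∎)
    where
    open PermutationReasoning
    m'+n≡ : m' + n ≡ 2 + (m' + n')
    m'+n≡ = trans (+-suc m' (suc n')) (cong suc (+-suc m' n'))

  αpre-low : All (λ v → 2 < v × v ≤ m) αpre
  αpre-low = tabulate αpre-values

  bar-βpre-high : All (λ v → v ≡ 2 ⊎ m < v) (map (bar m) βpre)
  bar-βpre-high = All.map⁺ (tabulate (bar-high ∘ βpre-values))
    where
    bar-high : ∀ {v} → v ≡ 2 ⊎ (2 < v × v ≤ n) → bar m v ≡ 2 ⊎ m < bar m v
    bar-high (inj₁ refl)     = inj₁ refl
    bar-high {v} (inj₂ (2<v , _)) = inj₂ (subst (m <_) (sym (bar-≥3 m' v 2<v)) (+-monoˡ-< m' 2<v))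

  no-312-before-last : Avoids p312 α → Avoids p312 β → ∀ {τ} → τ ⊆ αpre ++ map (bar m) βpre → ¬ Is312 τ
  no-312-before-last α-avoids β-avoids τ⊆ occ
    with ⊆-++⁻ αpre _ τ⊆
  ... | τ₁ , τ₂ , refl , τ₁⊆ , τ₂⊆
    with Is312-++⁻ τ₁ τ₂ (All-resp-⊆ τ₁⊆ αpre-low) (All-resp-⊆ τ₂⊆ bar-βpre-high) occ
  ... | inj₁ occ₁ = α-avoids (Contains-312⁺ (++⁺ʳ _ τ₁⊆) occ₁)
  ... | inj₂ occ₂ with ⊆-map⁻ (bar m) βpre τ₂⊆
  ...   | σ , refl , σ⊆ = β-avoids (Contains-312⁺ (++⁺ʳ _ σ⊆)
            (Is312-map⁻ (bar m) (bar-reflects-< m') (All-resp-⊆ σ⊆ βpre-≥2) occ₂))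
    where
    βpre-≥2 : All (2 ≤_) βpre
    βpre-≥2 = tabulate λ v∈ → [ (λ { refl → ≤-refl }) , <⇒≤ ∘ proj₁ ]′ (βpre-values v∈)

  γ-avoids : Avoids p312 α → Avoids p312 β → Avoids p312 γ
  γ-avoids α-avoids β-avoids occ with Contains-312⁻ occ
  ... | τ , τ⊆γ , occ′ with ⊆-++⁻ (αpre ++ map (bar m) βpre) (1 ∷ [])
                              (subst (τ ⊆_) (sym (++-assoc αpre _ _)) τ⊆γ)
  ... | σ , _ , refl , σ⊆ , _ ∷ʳ [] =
    no-312-before-last α-avoids β-avoids σ⊆ (subst Is312 (++-identityʳ σ) occ′)
  ... | σ , _ , refl , σ⊆ , refl ∷ [] =
    ¬Is312-∷ʳ-minimum σ (All-resp-⊆ σ⊆ (All.++⁺ (All.map (≤-trans (s≤s z≤n) ∘ <⇒≤ ∘ proj₁) αpre-low)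
                                                (All.map positive bar-βpre-high))) occ′
    where
    positive : ∀ {v} → v ≡ 2 ⊎ m < v → 1 ≤ v
    positive (inj₁ refl) = s≤s z≤n
    positive (inj₂ m<v)  = ≤-trans (s≤s z≤n) m<v

  within-βpre : ∀ {i} → i < suc n' → i < length βpre
  within-βpre = subst (_ <_) (sym length-βpre)

  γ-on-αpre : ∀ {i} → i < m' → at γ i ≡ at α i
  γ-on-αpre i<m' = trans (at-++ˡ αpre _ i<l) (sym (at-++ˡ αpre _ i<l))
    where i<l = subst (_ <_) (sym length-αpre) i<m'

  α-at-m' : at α m' ≡ 2
  α-at-m' = trans (cong (at α) (sym (+-identityʳ m'))) (at-++ʳ αpre _ 0 length-αpre)

  α-at-1+m' : at α (suc m') ≡ 1
  α-at-1+m' = trans (cong (at α) (+-comm 1 m')) (at-++ʳ αpre _ 1 length-αpre)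

  β-at-1+n' : at β (suc n') ≡ 1
  β-at-1+n' = trans (cong (at β) (sym (+-identityʳ (suc n')))) (at-++ʳ βpre _ 0 length-βpre)

  β-values : ∀ {i} → i < suc n' → at β i ≡ 2 ⊎ 2 < at β i
  β-values i<1+n' = subst (λ v → v ≡ 2 ⊎ 2 < v) (sym (at-++ˡ βpre _ i<l))
                           (Sum.map₂ proj₁ (βpre-values (at-∈ βpre i<l)))
    where i<l = within-βpre i<1+n'

  γ-on-βpre : ∀ {i} → i < suc n' → at γ (i + m') ≡ bar m (at β i)
  γ-on-βpre {i} i<1+n' = begin
    at γ (i + m')                           ≡⟨ cong (at γ) (+-comm i m') ⟩
    at γ (m' + i)                           ≡⟨ at-++ʳ αpre _ i length-αpre ⟩
    at (map (bar m) βpre ++ 1 ∷ []) i       ≡⟨ at-++ˡ (map (bar m) βpre) _ i<l′ ⟩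
    at (map (bar m) βpre) i                 ≡⟨ at-map (bar m) βpre i<l ⟩
    bar m (at βpre i)                       ≡⟨ cong (bar m) (sym (at-++ˡ βpre _ i<l)) ⟩
    bar m (at β i)                          ∎
    where
    open ≡-Reasoning
    i<l : i < length βpre
    i<l = within-βpre i<1+n'
    i<l′ : i < length (map (bar m) βpre)
    i<l′ = subst (i <_) (sym (length-map (bar m) βpre)) i<l

  Reach : ℕ → Set
  Reach y = ∃[ k ] iter γ k 1 ≡ y

  reach-1 : Reach 1
  reach-1 = 0 , refl

  reach-step : ∀ {x} → Reach x → Reach (apply γ x)
  reach-step (k , refl) = suc k , refl

  α-step : ∀ {T : Set} → (Reach (suc m') → T ⊎ Reach 2) →
           ∀ {x} → InRange m x → T ⊎ Reach x → T ⊎ Reach (apply α x)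
  α-step exit _ (inj₁ t) = inj₁ t
  α-step {T} exit {suc i} (_ , i<m) (inj₂ r) with <-cmp i m'
  ... | tri< i<m' _ _ = inj₂ (subst Reach (γ-on-αpre i<m') (reach-step r))
  ... | tri≈ _ refl _ = subst (λ v → T ⊎ Reach v) (sym α-at-m') (exit r)
  ... | tri> _ _ m'<i with ≤-antisym (s≤s⁻¹ i<m) m'<i
  ...   | refl = inj₂ (subst Reach (sym α-at-1+m') reach-1)

  γ-at-β-exit : ∀ {y} → InRange n y → apply β y ≡ 2 → apply γ (y + m') ≡ 2
  γ-at-β-exit {suc i} (_ , i<n) βy≡2 with m≤n⇒m<n∨m≡n (s≤s⁻¹ i<n)
  ... | inj₁ i<1+n' = trans (γ-on-βpre i<1+n') (cong (bar m) βy≡2)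
  ... | inj₂ refl   = contradiction (trans (sym β-at-1+n') βy≡2) λ ()

  β-step : ∀ {T : Set} → Reach (suc m') → (Reach 2 → T ⊎ Reach m) →
           ∀ {y} → InRange n y → T ⊎ Reach (y + m') → T ⊎ Reach (apply β y + m')
  β-step _ exit _ (inj₁ t) = inj₁ t
  β-step {T} reach-1+m' exit {suc i} y∈@(_ , i<n) (inj₂ r) with m≤n⇒m<n∨m≡n (s≤s⁻¹ i<n)
  ... | inj₂ refl = inj₂ (subst (λ v → Reach (v + m')) (sym β-at-1+n') reach-1+m')
  ... | inj₁ i<1+n' with β-values i<1+n'
  ...   | inj₁ βy≡2 =
    subst (λ v → T ⊎ Reach (v + m')) (sym βy≡2) (exit (subst Reach (γ-at-β-exit y∈ βy≡2) (reach-step r)))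
  ...   | inj₂ 2<βy = inj₂ (subst Reach (trans (γ-on-βpre i<1+n') (bar-≥3 m' _ 2<βy)) (reach-step r))

  module _ (α-cycle : IsCycle m α) (β-cycle : IsCycle n β) where

    reach-via-α : ∀ {T : Set} → (Reach (suc m') → T ⊎ Reach 2) → ∀ k → T ⊎ Reach (iter α k 1)
    reach-via-α {T} exit k = proj₂ (iter-preserves α Inv step k ((≤-refl , s≤s z≤n) , inj₂ reach-1))
      where
      Inv : ℕ → Set
      Inv x = InRange m x × (T ⊎ Reach x)
      step : ∀ {x} → Inv x → Inv (apply α x)
      step (x∈ , inv) = apply-inRange α↭ x∈ , α-step exit x∈ inv

    reach-1+m' : Reach (suc m')
    reach-1+m' with α-cycle (suc m') (s≤s z≤n) (n≤1+n _)
    ... | k , αᵏ1≡1+m' = reduce (subst (λ v → Reach (suc m') ⊎ Reach v) αᵏ1≡1+m' (reach-via-α inj₁ k))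

    reach-via-β : ∀ {T : Set} → (Reach 2 → T ⊎ Reach m) → ∀ k → T ⊎ Reach (iter β k 1 + m')
    reach-via-β {T} exit k = proj₂ (iter-preserves β Inv step k ((≤-refl , s≤s z≤n) , inj₂ reach-1+m'))
      where
      Inv : ℕ → Set
      Inv y = InRange n y × (T ⊎ Reach (y + m'))
      step : ∀ {y} → Inv y → Inv (apply β y)
      step (y∈ , inv) = apply-inRange β↭ y∈ , β-step reach-1+m' exit y∈ inv

    reach-2 : Reach 2
    reach-2 with β-cycle 2 (s≤s z≤n) (s≤s (s≤s z≤n))
    ... | suc k , βᵏ⁺¹1≡2 with reach-via-β inj₁ k
    ...   | inj₁ r = r
    ...   | inj₂ r = subst Reach (γ-at-β-exit (iter-inRange β↭ k (≤-refl , s≤s z≤n)) βᵏ⁺¹1≡2) (reach-step r)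

    reach-α : ∀ {j} → InRange m j → Reach j
    reach-α (1≤j , j≤m) with α-cycle _ 1≤j j≤m
    ... | k , refl = fromInj₂ ⊥-elim (reach-via-α (λ _ → inj₂ reach-2) k)

    reach-β : ∀ {y} → InRange n y → Reach (y + m')
    reach-β (1≤y , y≤n) with β-cycle _ 1≤y y≤n
    ... | k , refl = fromInj₂ ⊥-elim (reach-via-β (λ _ → inj₂ (reach-α (s≤s z≤n , ≤-refl))) k)

    γ-cycle : IsCycle (m + n ∸ 2) γ
    γ-cycle j 1≤j j≤m'+n with j ≤? m'
    ... | yes j≤m' = reach-α (1≤j , m≤n⇒m≤o+n 2 j≤m')
    ... | no j≰m'  = subst Reach (m∸n+n≡m (<⇒≤ (≰⇒> j≰m')))
      (reach-β (m<n⇒0<n∸m (≰⇒> j≰m') , subst (j ∸ m' ≤_) (m+n∸m≡n m' n) (∸-monoˡ-≤ m' j≤m'+n)))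

lemma3p6 : (m n : ℕ) → 2 ≤ m → 2 ≤ n → (αpre βpre : List ℕ) →
    InC m p312 (αpre ++ 2 ∷ 1 ∷ []) →
    InC n p312 (βpre ++ 1 ∷ []) →
    InC (m + n ∸ 2) p312 (star m αpre βpre)
lemma3p6 (suc (suc m')) (suc (suc n')) (s≤s (s≤s _)) (s≤s (s≤s _)) αpre βpre
         (α-perm , α-cycle , α-avoids) (β-perm , β-cycle , β-avoids) =
  γ-perm , γ-cycle α-cycle β-cycle , γ-avoids α-avoids β-avoids
  where open Star m' n' αpre βpre α-perm β-perm
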